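{- Let $f:\mathbb{N}_+\to\mathbb{N}_+$ and $n\in\mathbb{N}_+$, and define $\varphi=\varphi_{f(\cdot),n}:\mathbb{Z}\to\mathbb{N}$ by $\varphi(x)=0$ for $x<1$; $\varphi(x)=1$ for $1\le x\le f(n)$; and for $x>f(n)$, $$\varphi(x)=\max_{\lceil x/3\rceil\le y\le\lfloor 2x/3\rfloor}\{\varphi(y)+\varphi(x-f(x)-y)\}+1,$$ the maximum being over integers $y$. Then for all $x\ge f(n)$, $$\varphi_{f(\cdot),n}(x)\le\frac{6x}{f(n)}-1.$$ -}

module Defs where

open import Data.Nat using (ℕ; zero; suc; _+_; _*_; _∸_; _⊔_; _≤ᵇ_)
open import Data.Nat.DivMod using (_/_)
open import Data.Integer using (ℤ; +_; -[1+_])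
open import Data.List using (List; foldr; map; applyUpTo)
open import Data.Bool using (if_then_else_)

range : ℕ → ℕ → List ℕ
range lo hi = applyUpTo (λ i → lo + i) (suc hi ∸ lo)

-- max { g y : lo ≤ y ≤ hi }  (only ever used on non-empty ranges)
maxOver : (ℕ → ℕ) → ℕ → ℕ → ℕ
maxOver g lo hi = foldr _⊔_ 0 (map g (range lo hi))

ceil3 : ℕ → ℕ
ceil3 x = (x + 2) / 3

floor2x3 : ℕ → ℕ
floor2x3 x = (2 * x) / 3

-- Invariant: called with k ≥ x (see phiℕ); then every recursive call is on an
-- argument < x ≤ k, i.e. ≤ k-1, so the "out of fuel" clause is never reached.
-- For x ≥ 1 and y ≥ ceil3 x ≥ 1, the value x - f(x) - y, if negative, is
-- truncated to 0 by ∸, and φ(0) = 0 = φ(negative), matching the paper.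
phiFuel : (f : ℕ → ℕ) (n : ℕ) → ℕ → ℕ → ℕ
phiFuel f n k       zero    = 0
phiFuel f n zero    (suc x) = 0
phiFuel f n (suc k) (suc x) =
  if suc x ≤ᵇ f n
  then 1
  else suc (maxOver (λ y → phiFuel f n k y + phiFuel f n k (suc x ∸ f (suc x) ∸ y))
                    (ceil3 (suc x)) (floor2x3 (suc x)))

phiℕ : (f : ℕ → ℕ) (n : ℕ) → ℕ → ℕ
phiℕ f n x = phiFuel f n x x

phi : (f : ℕ → ℕ) (n : ℕ) → ℤ → ℕ
phi f n (+ x)      = phiℕ f n x
phi f n -[1+ _ ]   = 0

-- Writing F = f n, one shows (φ(x) + 1)·F ≤ max(2F, 6x) for every x ≥ 0 by induction on x; the
-- term 2F covers the base values φ(x) = 1 for 1 ≤ x ≤ F. For x > F, both parts of an admissible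
-- split y + (x − y) lie in [x/3, x), so for them 2F < 6·part and induction gives
-- (φ(y) + 1)·F ≤ 6y and (φ(x − f(x) − y) + 1)·F ≤ 6(x − y), the latter as x − f(x) − y ≤ x − y.
-- Adding the two bounds gives (φ(x) + 1)·F ≤ 6x.
module Submission where

open import Defs

module PhiBound where

  open import Data.Nat
  open import Data.Nat.Properties
  open import Data.Nat.DivMod using (m≡m%n+[m/n]*n; m%n<n; m/n*n≤m)
  open import Data.Bool using (true; false; T)
  open import Data.List.Properties using (foldr-preservesᵇ)
  open import Data.List.Relation.Unary.All as All using (All)
  open import Data.List.Relation.Unary.All.Properties using (map⁺; applyUpTo⁺₁)
  open import Data.Product using (_×_; _,_; proj₁; proj₂; uncurry)
  open import Data.Sum using (inj₁; inj₂)
  open import Relation.Binary.PropositionalEquality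

  ⊔-preserves : ∀ {p} (P : ℕ → Set p) {m n} → P m → P n → P (m ⊔ n)
  ⊔-preserves P {m} {n} pm pn with ⊔-sel m n
  ... | inj₁ m⊔n≡m = subst P (sym m⊔n≡m) pm
  ... | inj₂ m⊔n≡n = subst P (sym m⊔n≡n) pn

  range-bounds : ∀ lo hi → All (λ y → lo ≤ y × y ≤ hi) (range lo hi)
  range-bounds lo hi = applyUpTo⁺₁ (lo +_) (suc hi ∸ lo) (λ {i} i< → m≤m+n lo i , lo+i≤hi lo hi i<)
    where
    lo+i≤hi : ∀ lo hi {i} → i < suc hi ∸ lo → lo + i ≤ hi
    lo+i≤hi zero     hi       (s≤s i≤hi) = i≤hi
    lo+i≤hi (suc lo) zero {i} i<0        with () ← subst (i <_) (0∸n≡0 lo) i<0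
    lo+i≤hi (suc lo) (suc hi) i<         = s≤s (lo+i≤hi lo hi i<)

  maxOver-preserves : ∀ {p} (P : ℕ → Set p) (g : ℕ → ℕ) lo hi → P 0 →
                      (∀ {y} → lo ≤ y → y ≤ hi → P (g y)) → P (maxOver g lo hi)
  maxOver-preserves P g lo hi p0 pg =
    foldr-preservesᵇ {P = P} (⊔-preserves P) p0 (map⁺ (All.map (uncurry pg) (range-bounds lo hi)))

  m≤[m+n]/[1+n]*[1+n] : ∀ m n → m ≤ (m + n) / suc n * suc n
  m≤[m+n]/[1+n]*[1+n] m n = +-cancelʳ-≤ n m (q * suc n) (begin
    m + n                        ≡⟨ m≡m%n+[m/n]*n (m + n) (suc n) ⟩
    (m + n) % suc n + q * suc n  ≤⟨ +-monoˡ-≤ (q * suc n) (s≤s⁻¹ (m%n<n (m + n) (suc n))) ⟩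
    n + q * suc n                ≡⟨ +-comm n (q * suc n) ⟩
    q * suc n + n                ∎)
    where
    open ≤-Reasoning
    q = (m + n) / suc n

  m≤3*ceil3[m] : ∀ m → m ≤ 3 * ceil3 m
  m≤3*ceil3[m] m = ≤-trans (m≤[m+n]/[1+n]*[1+n] m 2) (≤-reflexive (*-comm (ceil3 m) 3))

  3*floor2x3[m]≤2*m : ∀ m → 3 * floor2x3 m ≤ 2 * m
  3*floor2x3[m]≤2*m m = ≤-trans (≤-reflexive (*-comm 3 (floor2x3 m))) (m/n*n≤m (2 * m) 3)

  3*n≤2*m⇒m≤3*[m∸n] : ∀ {m n} → 3 * n ≤ 2 * m → m ≤ 3 * (m ∸ n)
  3*n≤2*m⇒m≤3*[m∸n] {m} {n} 3n≤2m = begin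
    m                ≡⟨ m+n∸n≡m m (2 * m) ⟨
    3 * m ∸ 2 * m    ≤⟨ ∸-monoʳ-≤ (3 * m) 3n≤2m ⟩
    3 * m ∸ 3 * n    ≡⟨ *-distribˡ-∸ 3 m n ⟨
    3 * (m ∸ n)      ∎
    where open ≤-Reasoning

  ThirdPart : ℕ → ℕ → Set
  ThirdPart x w = w < x × x ≤ 3 * w

  middle-third-parts : ∀ {x y} → ceil3 (suc x) ≤ y → y ≤ floor2x3 (suc x) →
                       ThirdPart (suc x) y × ThirdPart (suc x) (suc x ∸ y)
  middle-third-parts {x} {y} lo≤y y≤hi =
    (y<X , X≤3y) , (∸-monoʳ-< 0<y (<⇒≤ y<X) , 3*n≤2*m⇒m≤3*[m∸n] {X} {y} 3y≤2X)
    where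
    X = suc x
    X≤3y : X ≤ 3 * y
    X≤3y = ≤-trans (m≤3*ceil3[m] X) (*-monoʳ-≤ 3 lo≤y)
    3y≤2X : 3 * y ≤ 2 * X
    3y≤2X = ≤-trans (*-monoʳ-≤ 3 y≤hi) (3*floor2x3[m]≤2*m X)
    y<X : y < X
    y<X = *-cancelˡ-< 3 y X (≤-<-trans 3y≤2X (*-monoˡ-< X (n<1+n 2)))
    0<y : 0 < y
    0<y = *-cancelˡ-< 3 0 y (<-≤-trans z<s X≤3y)

  2*m≤6*n : ∀ {m n} → m ≤ 3 * n → 2 * m ≤ 6 * n
  2*m≤6*n {m} {n} m≤3n = ≤-trans (*-monoʳ-≤ 2 m≤3n) (≤-reflexive (sym (*-assoc 2 3 n)))

  2*m⊔6*z≤6*n : ∀ {m n z} → m ≤ 3 * n → z ≤ n → 2 * m ⊔ 6 * z ≤ 6 * n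
  2*m⊔6*z≤6*n {n = n} m≤3n z≤n′ = ⊔-lub (2*m≤6*n {n = n} m≤3n) (*-monoʳ-≤ 6 z≤n′)

  [2+a+b]*F≤6*[m+n] : ∀ a b F m n → suc a * F ≤ 6 * m → suc b * F ≤ 6 * n →
                      suc (suc (a + b)) * F ≤ 6 * (m + n)
  [2+a+b]*F≤6*[m+n] a b F m n am bn = begin
    suc (suc (a + b)) * F    ≡⟨ cong (λ t → suc t * F) (+-suc a b) ⟨
    (suc a + suc b) * F      ≡⟨ *-distribʳ-+ F (suc a) (suc b) ⟩
    suc a * F + suc b * F    ≤⟨ +-mono-≤ am bn ⟩
    6 * m + 6 * n            ≡⟨ *-distribˡ-+ 6 m n ⟨
    6 * (m + n)              ∎
    where open ≤-Reasoning

  module _ (f : ℕ → ℕ) (n : ℕ) where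

    phiFuel-bound : ∀ k x → x ≤ k → suc (phiFuel f n k x) * f n ≤ 2 * f n ⊔ 6 * x
    phiFuel-bound k       zero    _ = ≤-trans (+-monoʳ-≤ (f n) z≤n) (m≤m⊔n (2 * f n) 0)
    phiFuel-bound zero    (suc x) ()
    phiFuel-bound (suc k) (suc x) (s≤s x≤k) with suc x ≤ᵇ f n in X≰ᵇF
    ... | true  = m≤m⊔n (2 * f n) (6 * suc x)
    ... | false = m≤n⇒m≤o⊔n (2 * f n)
        (maxOver-preserves (λ m → suc (suc m) * f n ≤ 6 * X) _ (ceil3 X) (floor2x3 X)
          (2*m≤6*n {n = X} F≤3X) split-bound)
      where
      X = suc x
      F<X : f n < X
      F<X = ≰⇒> (λ X≤F → subst T X≰ᵇF (≤⇒≤ᵇ X≤F))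
      F≤3X : f n ≤ 3 * X
      F≤3X = ≤-trans (<⇒≤ F<X) (m≤n*m X 3)
      part-bound : ∀ {z} w → z ≤ w → ThirdPart X w → suc (phiFuel f n k z) * f n ≤ 6 * w
      part-bound w z≤w (w<X , X≤3w) =
        ≤-trans (phiFuel-bound k _ (≤-trans z≤w (≤-trans (s≤s⁻¹ w<X) x≤k)))
                (2*m⊔6*z≤6*n {n = w} (≤-trans (<⇒≤ F<X) X≤3w) z≤w)
      split-bound : ∀ {y} → ceil3 X ≤ y → y ≤ floor2x3 X →
                    suc (suc (phiFuel f n k y + phiFuel f n k (X ∸ f X ∸ y))) * f n ≤ 6 * X
      split-bound {y} lo≤y y≤hi =
        subst (λ t → suc (suc (a + b)) * f n ≤ 6 * t) (m+[n∸m]≡n (<⇒≤ (proj₁ y-part)))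
          ([2+a+b]*F≤6*[m+n] a b (f n) y (X ∸ y)
            (part-bound y ≤-refl y-part)
            (part-bound (X ∸ y) (∸-monoˡ-≤ y (m∸n≤m X (f X))) rest-part))
        where
        a = phiFuel f n k y
        b = phiFuel f n k (X ∸ f X ∸ y)
        parts = middle-third-parts lo≤y y≤hi
        y-part = proj₁ parts
        rest-part = proj₂ parts

    phiℕ-bound : ∀ {x} → f n ≤ x → (phiℕ f n x + 1) * f n ≤ 6 * x
    phiℕ-bound {x} F≤x =
      subst (λ t → t * f n ≤ 6 * x) (+-comm 1 (phiℕ f n x))
        (≤-trans (phiFuel-bound x x ≤-refl) (2*m⊔6*z≤6*n {n = x} (≤-trans F≤x (m≤n*m x 3)) ≤-refl))

open PhiBound using (phiℕ-bound)

open import Data.Nat using (ℕ; _<_)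
import Data.Nat as ℕ
open import Data.Integer using (ℤ; +_; _≤_; _+_; _*_; +≤+)
open import Data.Integer.Properties using (pos-*; pos-+)
open import Relation.Binary.PropositionalEquality using (subst₂; trans; cong)

proposition2 : (f : ℕ → ℕ) → (∀ m → 0 < m → 0 < f m) →
               (n : ℕ) → 0 < n →
               (x : ℤ) → + (f n) ≤ x →
               (+ (phi f n x) + + 1) * + (f n) ≤ + 6 * x
proposition2 f _ n _ (+ x) (+≤+ f[n]≤x) =
  subst₂ _≤_ (trans (pos-* (phiℕ f n x ℕ.+ 1) (f n)) (cong (_* + f n) (pos-+ (phiℕ f n x) 1)))
             (pos-* 6 x)
             (+≤+ (phiℕ-bound f n f[n]≤x))
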